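{- Every list type (possibly using the type $0$) admits a derivable isomorphism with some list type in disjunctive normal form, i.e. there are functions $f:\Sigma\to\Sigma'$ and $g:\Sigma'\to\Sigma$, both derivable in the extended quantifier-free system, which are mutually inverse, where $\Sigma'$ is in disjunctive normal form.
   Context: List types are generated by $1$, $0$, $\Sigma_1\times\Sigma_2$, $\Sigma_1+\Sigma_2$ (tagged disjoint union) and $\Sigma^*$; $0$ denotes the class containing exactly one structure, whose universe is empty. A list type is in disjunctive normal form if it has the form $\coprod_{i\in I}\prod_{j\in I_i}\Sigma_{i,j}$ where each $\Sigma_{i,j}$ is $0$, $1$, or $\Sigma^*$ with $\Sigma$ in disjunctive normal form (no product of co-products occurs). The extended quantifier-free system derives functions from the primes: commutativity of $\times$ and $+$; associativity of $\times$ and $+$; distributivity $\Gamma\times(\Sigma+\Delta)\leftrightarrow(\Gamma\times\Sigma)+(\Gamma\times\Delta)$; projections $\Gamma_1\times\Gamma_2\to\Gamma_i$; co-projections $\Gamma_i\to\Gamma_1+\Gamma_2$; co-diagonal $\Gamma+\Gamma\to\Gamma$; append $\Sigma^*\times\Sigma\to\Sigma^*$; reverse $\Sigma^*\to\Sigma^*$; concat $\Sigma^{**}\to\Sigma^*$; create empty $\Sigma\to\Sigma\times\Gamma^*$, $x\mapsto(x,[\,])$; list distribute $(\Sigma\times\Gamma)^*\to\Sigma^*\times\Gamma^*$; add $0$: $\Sigma\to\Sigma\times0$; create an empty list $0\to\Sigma^*$; using the combinators function composition and functoriality of $\times$, $+$ and $*$. -}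

module Defs where

open import Data.Unit using (⊤; tt)
open import Data.Product using (_×_; _,_; proj₁; proj₂)
open import Data.Sum using (_⊎_; inj₁; inj₂; [_,_]′; map)
open import Data.List using (List; []; _∷_; _++_; [_]; reverse; concat; unzip)
import Data.List as L

infixr 7 _⊗_
infixr 6 _⊕_
data Ty : Set where
  𝟘   : Ty
  𝟙   : Ty
  _⊗_ : Ty → Ty → Ty
  _⊕_ : Ty → Ty → Ty
  _*  : Ty → Ty

-- Semantics: the class of structures denoted by a list type.
-- 0 denotes exactly one structure (the empty one), 1 exactly one structure.
data Zero : Set where
  empty : Zero

⟦_⟧ : Ty → Set
⟦ 𝟘 ⟧     = Zero
⟦ 𝟙 ⟧     = ⊤
⟦ A ⊗ B ⟧ = ⟦ A ⟧ × ⟦ B ⟧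
⟦ A ⊕ B ⟧ = ⟦ A ⟧ ⊎ ⟦ B ⟧
⟦ A * ⟧   = List ⟦ A ⟧

data Der : Ty → Ty → Set where
  ⊗-comm   : ∀ {A B} → Der (A ⊗ B) (B ⊗ A)
  ⊕-comm   : ∀ {A B} → Der (A ⊕ B) (B ⊕ A)
  ⊗-assoc  : ∀ {A B C} → Der ((A ⊗ B) ⊗ C) (A ⊗ (B ⊗ C))
  ⊗-assoc⁻ : ∀ {A B C} → Der (A ⊗ (B ⊗ C)) ((A ⊗ B) ⊗ C)
  ⊕-assoc  : ∀ {A B C} → Der ((A ⊕ B) ⊕ C) (A ⊕ (B ⊕ C))
  ⊕-assoc⁻ : ∀ {A B C} → Der (A ⊕ (B ⊕ C)) ((A ⊕ B) ⊕ C)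
  distr    : ∀ {G S D} → Der (G ⊗ (S ⊕ D)) ((G ⊗ S) ⊕ (G ⊗ D))
  distr⁻   : ∀ {G S D} → Der ((G ⊗ S) ⊕ (G ⊗ D)) (G ⊗ (S ⊕ D))
  π₁       : ∀ {A B} → Der (A ⊗ B) A
  π₂       : ∀ {A B} → Der (A ⊗ B) B
  ι₁       : ∀ {A B} → Der A (A ⊕ B)
  ι₂       : ∀ {A B} → Der B (A ⊕ B)
  codiag   : ∀ {A} → Der (A ⊕ A) A
  append   : ∀ {S} → Der ((S *) ⊗ S) (S *)
  rev      : ∀ {S} → Der (S *) (S *)
  concatD  : ∀ {S} → Der ((S *) *) (S *)
  createEmpty : ∀ {S G} → Der S (S ⊗ (G *))
  listDistr   : ∀ {S G} → Der ((S ⊗ G) *) ((S *) ⊗ (G *))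
  add0     : ∀ {S} → Der S (S ⊗ 𝟘)
  emptyList : ∀ {S} → Der 𝟘 (S *)
  _∘D_     : ∀ {A B C} → Der B C → Der A B → Der A C
  _⊗D_     : ∀ {A A′ B B′} → Der A A′ → Der B B′ → Der (A ⊗ B) (A′ ⊗ B′)
  _⊕D_     : ∀ {A A′ B B′} → Der A A′ → Der B B′ → Der (A ⊕ B) (A′ ⊕ B′)
  mapD     : ∀ {A B} → Der A B → Der (A *) (B *)

run : ∀ {A B} → Der A B → ⟦ A ⟧ → ⟦ B ⟧
run ⊗-comm (a , b) = b , a
run ⊕-comm (inj₁ a) = inj₂ a
run ⊕-comm (inj₂ b) = inj₁ b
run ⊗-assoc ((a , b) , c) = a , (b , c)
run ⊗-assoc⁻ (a , (b , c)) = (a , b) , c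
run ⊕-assoc (inj₁ (inj₁ a)) = inj₁ a
run ⊕-assoc (inj₁ (inj₂ b)) = inj₂ (inj₁ b)
run ⊕-assoc (inj₂ c) = inj₂ (inj₂ c)
run ⊕-assoc⁻ (inj₁ a) = inj₁ (inj₁ a)
run ⊕-assoc⁻ (inj₂ (inj₁ b)) = inj₁ (inj₂ b)
run ⊕-assoc⁻ (inj₂ (inj₂ c)) = inj₂ c
run distr (g , inj₁ s) = inj₁ (g , s)
run distr (g , inj₂ d) = inj₂ (g , d)
run distr⁻ (inj₁ (g , s)) = g , inj₁ s
run distr⁻ (inj₂ (g , d)) = g , inj₂ d
run π₁ (a , b) = a
run π₂ (a , b) = b
run ι₁ a = inj₁ a
run ι₂ b = inj₂ b
run codiag (inj₁ a) = a
run codiag (inj₂ a) = a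
run append (xs , x) = xs ++ [ x ]
run rev xs = reverse xs
run concatD xss = concat xss
run createEmpty x = x , []
run listDistr xs = unzip xs
run add0 x = x , empty
run emptyList _ = []
run (g ∘D f) x = run g (run f x)
run (f ⊗D g) (a , b) = run f a , run g b
run (f ⊕D g) (inj₁ a) = inj₁ (run f a)
run (f ⊕D g) (inj₂ b) = inj₂ (run g b)
run (mapD f) xs = L.map (run f) xs

data DNF : Ty → Set
data Prod : Ty → Set
data Atom : Ty → Set

data Atom where
  atom𝟘 : Atom 𝟘
  atom𝟙 : Atom 𝟙
  atom* : ∀ {S} → DNF S → Atom (S *)

data Prod where
  prodAtom : ∀ {A} → Atom A → Prod A
  prod⊗    : ∀ {A B} → Prod A → Prod B → Prod (A ⊗ B)

data DNF where
  dnfProd : ∀ {A} → Prod A → DNF A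
  dnf⊕    : ∀ {A B} → DNF A → DNF B → DNF (A ⊕ B)

-- Sums,
-- lists and atoms are already in normal form once their components are; the only
-- real work is a product of two normal forms, which distributivity (on either side,
-- via commutativity) rewrites into a sum of products of atoms.
module Submission where

open import Defs
open import Function using (_∘_)
open import Data.Product using (_×_; Σ-syntax; _,_)
open import Data.Sum using (inj₁; inj₂)
import Data.List as L
open import Data.List.Properties using (map-id; map-cong; map-∘)
open import Relation.Binary.PropositionalEquality
  using (_≡_; refl; sym; cong; cong₂; trans; module ≡-Reasoning)

infix  4 _≅_
infixr 9 _∘≅_
infixr 7 _⊗≅_
infixr 6 _⊕≅_

record _≅_ (A B : Ty) : Set where
  field
    to      : Der A B
    from    : Der B A
    from∘to : ∀ x → run from (run to x) ≡ x
    to∘from : ∀ y → run to (run from y) ≡ y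
open _≅_

-- The system has no identity prime; this composite of two primes plays its role.
idD : ∀ {A} → Der A A
idD = codiag ∘D ι₁

≅-refl : ∀ {A} → A ≅ A
≅-refl = record { to = idD ; from = idD ; from∘to = λ _ → refl ; to∘from = λ _ → refl }

_∘≅_ : ∀ {A B C} → B ≅ C → A ≅ B → A ≅ C
j ∘≅ i = record
  { to      = to j ∘D to i
  ; from    = from i ∘D from j
  ; from∘to = λ x → trans (cong (run (from i)) (from∘to j (run (to i) x))) (from∘to i x)
  ; to∘from = λ y → trans (cong (run (to j)) (to∘from i (run (from j) y))) (to∘from j y)
  }

_⊗≅_ : ∀ {A A′ B B′} → A ≅ A′ → B ≅ B′ → A ⊗ B ≅ A′ ⊗ B′
i ⊗≅ j = record
  { to      = to i ⊗D to j
  ; from    = from i ⊗D from j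
  ; from∘to = λ { (a , b) → cong₂ _,_ (from∘to i a) (from∘to j b) }
  ; to∘from = λ { (a , b) → cong₂ _,_ (to∘from i a) (to∘from j b) }
  }

_⊕≅_ : ∀ {A A′ B B′} → A ≅ A′ → B ≅ B′ → A ⊕ B ≅ A′ ⊕ B′
i ⊕≅ j = record
  { to      = to i ⊕D to j
  ; from    = from i ⊕D from j
  ; from∘to = λ { (inj₁ a) → cong inj₁ (from∘to i a) ; (inj₂ b) → cong inj₂ (from∘to j b) }
  ; to∘from = λ { (inj₁ a) → cong inj₁ (to∘from i a) ; (inj₂ b) → cong inj₂ (to∘from j b) }
  }

map-inverse : ∀ {X Y : Set} {f : X → Y} {g : Y → X} →
  (∀ x → g (f x) ≡ x) → ∀ xs → L.map g (L.map f xs) ≡ xs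
map-inverse {f = f} {g} g∘f≗id xs = begin
  L.map g (L.map f xs)  ≡⟨ sym (map-∘ xs) ⟩
  L.map (g ∘ f) xs      ≡⟨ map-cong g∘f≗id xs ⟩
  L.map (λ x → x) xs    ≡⟨ map-id xs ⟩
  xs                    ∎
  where open ≡-Reasoning

_*≅ : ∀ {A B} → A ≅ B → A * ≅ B *
i *≅ = record
  { to      = mapD (to i)
  ; from    = mapD (from i)
  ; from∘to = map-inverse (from∘to i)
  ; to∘from = map-inverse (to∘from i)
  }

⊗-comm≅ : ∀ {A B} → A ⊗ B ≅ B ⊗ A
⊗-comm≅ = record { to = ⊗-comm ; from = ⊗-comm ; from∘to = λ _ → refl ; to∘from = λ _ → refl }

⊗-distribˡ-⊕≅ : ∀ {G S D} → G ⊗ (S ⊕ D) ≅ (G ⊗ S) ⊕ (G ⊗ D)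
⊗-distribˡ-⊕≅ = record
  { to      = distr
  ; from    = distr⁻
  ; from∘to = λ { (_ , inj₁ _) → refl ; (_ , inj₂ _) → refl }
  ; to∘from = λ { (inj₁ _) → refl ; (inj₂ _) → refl }
  }

⊗-distribʳ-⊕≅ : ∀ {G S D} → (S ⊕ D) ⊗ G ≅ (S ⊗ G) ⊕ (D ⊗ G)
⊗-distribʳ-⊕≅ = (⊗-comm≅ ⊕≅ ⊗-comm≅) ∘≅ ⊗-distribˡ-⊕≅ ∘≅ ⊗-comm≅

record Normal (A : Ty) : Set where
  constructor normal
  field
    {nf}  : Ty
    isDNF : DNF nf
    iso   : A ≅ nf
open Normal

Normal-resp-≅ : ∀ {A B} → A ≅ B → Normal B → Normal A
Normal-resp-≅ i (normal d j) = normal d (j ∘≅ i)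

Normal-⊕ : ∀ {A B} → Normal A → Normal B → Normal (A ⊕ B)
Normal-⊕ (normal da ia) (normal db ib) = normal (dnf⊕ da db) (ia ⊕≅ ib)

Prod⊗DNF : ∀ {A B} → Prod A → DNF B → Normal (A ⊗ B)
Prod⊗DNF p (dnfProd q)  = normal (dnfProd (prod⊗ p q)) ≅-refl
Prod⊗DNF p (dnf⊕ b₁ b₂) =
  Normal-resp-≅ ⊗-distribˡ-⊕≅ (Normal-⊕ (Prod⊗DNF p b₁) (Prod⊗DNF p b₂))

DNF⊗DNF : ∀ {A B} → DNF A → DNF B → Normal (A ⊗ B)
DNF⊗DNF (dnfProd p)  b = Prod⊗DNF p b
DNF⊗DNF (dnf⊕ a₁ a₂) b =
  Normal-resp-≅ ⊗-distribʳ-⊕≅ (Normal-⊕ (DNF⊗DNF a₁ b) (DNF⊗DNF a₂ b))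

Normal-⊗ : ∀ {A B} → Normal A → Normal B → Normal (A ⊗ B)
Normal-⊗ (normal da ia) (normal db ib) = Normal-resp-≅ (ia ⊗≅ ib) (DNF⊗DNF da db)

Normal-* : ∀ {A} → Normal A → Normal (A *)
Normal-* (normal d i) = normal (dnfProd (prodAtom (atom* d))) (i *≅)

normalise : (S : Ty) → Normal S
normalise 𝟘       = normal (dnfProd (prodAtom atom𝟘)) ≅-refl
normalise 𝟙       = normal (dnfProd (prodAtom atom𝟙)) ≅-refl
normalise (A ⊗ B) = Normal-⊗ (normalise A) (normalise B)
normalise (A ⊕ B) = Normal-⊕ (normalise A) (normalise B)
normalise (A *)   = Normal-* (normalise A)

lemma1 : (S : Ty) →
    Σ[ S′ ∈ Ty ] DNF S′ ×
      (Σ[ f ∈ Der S S′ ] Σ[ g ∈ Der S′ S ]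
        ((∀ x → run g (run f x) ≡ x) × (∀ y → run f (run g y) ≡ y)))
lemma1 S = nf N , isDNF N , to (iso N) , from (iso N) , from∘to (iso N) , to∘from (iso N)
  where
    N : Normal S
    N = normalise S
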